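{- For every integer $\ell\ge 2$ and every $d\in(0,1)$, if $n\ge 2(4/d)^{\ell-2}$ and $0<\rho\le (d/4)^{\ell-2}/2$, then every $n$-vertex $(\rho,d)$-dense graph $\Gamma$ whose edges are colored with two colors contains at least $$f_n(\ell):=\left(\frac14\right)^{\binom{\ell+1}{2}}d^{\binom{\ell}{2}}n^{\ell}$$ canonical sequences of length $\ell$.
   Context: For $0<d,\rho\le1$, an $n$-vertex graph $\Gamma$ is $(\rho,d)$-dense if every induced subgraph of $\Gamma$ on $m\ge\rho n$ vertices contains at least $d\,m^2/2$ edges. Given a two-coloring of the edges of $\Gamma$, a sequence of vertices $(v_1,\dots,v_\ell)$ of $\Gamma$ is canonical if for each $i=1,\dots,\ell-1$ all the pairs $\{v_i,v_j\}$ with $j>i$ are edges of $\Gamma$ and all of them have the same color.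
   Formalization: The parameters d and ρ are taken to be rational numbers. -}

module Defs where

open import Data.Bool using (Bool; true; false; _∧_; if_then_else_)
open import Data.Nat using (ℕ; zero; suc; _+_)
open import Data.Fin using (Fin; zero; suc; _<?_)
open import Data.Fin.Subset using (Subset; ∣_∣)
open import Data.Vec using (lookup; []; _∷_)
open import Data.Bool using (_≟_)
open import Relation.Nullary.Decidable using (⌊_⌋)
open import Relation.Binary.PropositionalEquality using (_≡_)
open import Data.Rational using (ℚ; 1ℚ; _*_; _≤_; _/_)
open import Data.Integer using (+_)

_^ℚ_ : ℚ → ℕ → ℚ
q ^ℚ zero = 1ℚ
q ^ℚ suc k = q * (q ^ℚ k)
infixr 8 _^ℚ_

toℚ : ℕ → ℚ
toℚ m = + m / 1

Σᶠ : (m : ℕ) → (Fin m → ℕ) → ℕ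
Σᶠ zero f = 0
Σᶠ (suc m) f = f zero + Σᶠ m (λ i → f (suc i))

∀ᶠ : (m : ℕ) → (Fin m → Bool) → Bool
∀ᶠ zero f = true
∀ᶠ (suc m) f = f zero ∧ ∀ᶠ m (λ i → f (suc i))

record Graph (n : ℕ) : Set where
  field
    adj   : Fin n → Fin n → Bool
    sym   : ∀ u v → adj u v ≡ adj v u
    irrefl : ∀ u → adj u u ≡ false
open Graph public

-- A two-colouring of the edges: a symmetric Boolean colour on pairs
-- (only its values on edges matter).
record Colouring {n : ℕ} (Γ : Graph n) : Set where
  field
    col    : Fin n → Fin n → Bool
    colSym : ∀ u v → col u v ≡ col v u
open Colouring public

edgesIn : {n : ℕ} → Graph n → Subset n → ℕ
edgesIn {n} Γ S =
  Σᶠ n (λ u → Σᶠ n (λ v →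
    if lookup S u ∧ lookup S v ∧ ⌊ u <? v ⌋ ∧ adj Γ u v then 1 else 0))

Dense : {n : ℕ} → ℚ → ℚ → Graph n → Set
Dense {n} ρ d Γ = (S : Subset n) → ρ * (toℚ n) ≤ (toℚ ∣ S ∣) →
  d * (toℚ ∣ S ∣) * (toℚ ∣ S ∣) * (+ 1 / 2) ≤ (toℚ (edgesIn Γ S))

canonical : {n : ℕ} (Γ : Graph n) → Colouring Γ → (ℓ : ℕ) → (Fin ℓ → Fin n) → Bool
canonical Γ c ℓ v =
  ∀ᶠ ℓ (λ i → ∀ᶠ ℓ (λ j → ∀ᶠ ℓ (λ k →
    if ⌊ i <? j ⌋ ∧ ⌊ i <? k ⌋
    then adj Γ (v i) (v j) ∧ ⌊ col c (v i) (v j) ≟ col c (v i) (v k) ⌋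
    else true)))

countSeq : (n k : ℕ) → ((Fin k → Fin n) → Bool) → ℕ
countSeq n zero P = if P (λ ()) then 1 else 0
countSeq n (suc k) P = Σᶠ n (λ x → countSeq n k (λ s → P (λ { zero → x ; (suc i) → s i })))

numCanonical : {n : ℕ} (Γ : Graph n) → Colouring Γ → ℕ → ℕ
numCanonical {n} Γ c ℓ = countSeq n ℓ (canonical Γ c ℓ)

-- In a vertex set S of size m, every x ∈ S keeps the
-- colour in which it has more neighbours inside S; call these neighbours N(x).
-- Then |N(x)| ≥ deg_S(x)/2, so Σ_x |N(x)| ≥ e(S) ≥ d m²/2 by density, and putting
-- x in front of a canonical sequence inside N(x) gives a canonical sequence in S.
-- With X = (d/4) m: if |N(x)| ≥ X, induction inside N(x) gives at least
-- c_k |N(x)|^(k+1) ≥ c_k X^k |N(x)| such sequences; otherwise |N(x)| < X. Summing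
-- over x, S has at least c_k X^k (d m²/2 − X m) = c_k X^k d m²/4 = c_(k+1) m^(k+2)
-- canonical sequences of length k + 2, where c_0 = 1/4 and c_(k+1) = c_k (d/4)^(k+1).
-- Density is applied to sets with ρ n ≤ (d/4)^k m/2 at level k + 1, and neighbourhoods
-- of size at least (d/4) m inherit this condition at level k. The resulting bound
-- (1/4) (d/4)^C(ℓ,2) n^ℓ dominates f_n(ℓ).
module Submission where

open import Defs
open import Data.Nat using (ℕ; _∸_; _≥_; _+_)
open import Data.Nat.Combinatorics using (_C_)
open import Data.Rational using (ℚ; 0ℚ; 1ℚ; _*_; _≤_; _<_; _/_)
open import Data.Integer using (+_)

open import Data.Bool using (Bool; true; false; _∧_; if_then_else_)
import Data.Bool as Bool
open import Data.Empty using (⊥-elim)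
open import Data.Fin using (Fin; zero; suc; _<?_)
import Data.Fin as Fin
import Data.Fin.Properties as Finₚ
open import Data.Fin.Subset using (Subset; ∣_∣; ⊤)
open import Data.Fin.Subset.Properties using (∣⊤∣≡n)
import Data.Integer as Int
import Data.Integer.Properties as Intₚ
import Data.Nat as Nat
open Nat using (zero; suc; z≤n; s≤s)
import Data.Nat.Combinatorics as Natᶜ
import Data.Nat.Coprimality as Coprimality
import Data.Nat.Properties as Natₚ
open import Algebra.Properties.CommutativeMonoid.Sum Natₚ.+-0-commutativeMonoid
  using (sum; ∑-distrib-+)
open import Data.Product using (_×_; _,_; proj₁; proj₂)
import Data.Rational as Rat
import Data.Rational.Properties as Ratₚ
open import Data.Rational.Solver using (module +-*-Solver)
import Data.Rational.Unnormalised as ℚᵘ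
import Data.Rational.Unnormalised.Properties as ℚᵘₚ
open import Data.Sum using (_⊎_; inj₁; inj₂)
open import Data.Unit using (tt) renaming (⊤ to Unit)
open import Data.Vec using ([]; _∷_; lookup; tabulate)
open import Data.Vec.Properties using (lookup∘tabulate; lookup-replicate)
open import Function using (_∘_)
open import Relation.Binary.PropositionalEquality as ≡
  using (_≡_; refl; cong; cong₂; subst; subst₂; module ≡-Reasoning)
open import Relation.Nullary using (yes; no)
open import Relation.Nullary.Decidable using (⌊_⌋)

-- Rational arithmetic

toℚᵘ-toℚ : ∀ m → Rat.toℚᵘ (toℚ m) ≡ ℚᵘ.mkℚᵘ (+ m) 0
toℚᵘ-toℚ m rewrite Ratₚ.normalize-coprime (Coprimality.sym (Coprimality.1-coprimeTo m)) = refl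

toℚ-+ : ∀ a b → toℚ (a + b) ≡ toℚ a Rat.+ toℚ b
toℚ-+ a b = Ratₚ.toℚᵘ-injective (begin
  Rat.toℚᵘ (toℚ (a + b))                  ≡⟨ toℚᵘ-toℚ (a + b) ⟩
  ℚᵘ.mkℚᵘ (+ (a + b)) 0                   ≡⟨ cong (λ z → ℚᵘ.mkℚᵘ z 0) (≡.sym (cong₂ Int._+_
                                               (Intₚ.*-identityʳ (+ a)) (Intₚ.*-identityʳ (+ b)))) ⟩
  ℚᵘ.mkℚᵘ (+ a) 0 ℚᵘ.+ ℚᵘ.mkℚᵘ (+ b) 0    ≡⟨ ≡.sym (cong₂ ℚᵘ._+_ (toℚᵘ-toℚ a) (toℚᵘ-toℚ b)) ⟩
  Rat.toℚᵘ (toℚ a) ℚᵘ.+ Rat.toℚᵘ (toℚ b)  ≈⟨ Ratₚ.toℚᵘ-homo-+ (toℚ a) (toℚ b) ⟨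
  Rat.toℚᵘ (toℚ a Rat.+ toℚ b)            ∎)
  where open ℚᵘₚ.≃-Reasoning

toℚ-mono : ∀ {a b} → a Nat.≤ b → toℚ a ≤ toℚ b
toℚ-mono {a} {b} a≤b = Ratₚ.toℚᵘ-cancel-≤
  (subst₂ ℚᵘ._≤_ (≡.sym (toℚᵘ-toℚ a)) (≡.sym (toℚᵘ-toℚ b))
    (ℚᵘ.*≤* (Intₚ.*-monoʳ-≤-nonNeg (+ 1) (Int.+≤+ a≤b))))

toℚ-nonNeg : ∀ a → 0ℚ ≤ toℚ a
toℚ-nonNeg a = toℚ-mono {0} {a} z≤n

*-monoˡ-≤-0≤ : ∀ {r p q} → 0ℚ ≤ r → p ≤ q → r * p ≤ r * q
*-monoˡ-≤-0≤ {r} 0≤r = Ratₚ.*-monoˡ-≤-nonNeg r {{Rat.nonNegative 0≤r}}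

*-monoʳ-≤-0≤ : ∀ {r p q} → 0ℚ ≤ r → p ≤ q → p * r ≤ q * r
*-monoʳ-≤-0≤ {r} 0≤r = Ratₚ.*-monoʳ-≤-nonNeg r {{Rat.nonNegative 0≤r}}

*-mono-≤-0≤ : ∀ {p q r s} → 0ℚ ≤ p → 0ℚ ≤ s → p ≤ q → r ≤ s → p * r ≤ q * s
*-mono-≤-0≤ 0≤p 0≤s p≤q r≤s = Ratₚ.≤-trans (*-monoˡ-≤-0≤ 0≤p r≤s) (*-monoʳ-≤-0≤ 0≤s p≤q)

0≤-* : ∀ {p q} → 0ℚ ≤ p → 0ℚ ≤ q → 0ℚ ≤ p * q
0≤-* {p} 0≤p 0≤q = Ratₚ.≤-trans (Ratₚ.≤-reflexive (≡.sym (Ratₚ.*-zeroʳ p))) (*-monoˡ-≤-0≤ 0≤p 0≤q)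

p≤p+q : ∀ {p q} → 0ℚ ≤ q → p ≤ p Rat.+ q
p≤p+q {p} {q} 0≤q = subst (_≤ p Rat.+ q) (Ratₚ.+-identityʳ p) (Ratₚ.+-monoʳ-≤ p 0≤q)

p≤q+p : ∀ {p q} → 0ℚ ≤ q → p ≤ q Rat.+ p
p≤q+p {p} {q} 0≤q = subst (_≤ q Rat.+ p) (Ratₚ.+-identityˡ p) (Ratₚ.+-monoˡ-≤ p 0≤q)

+-cancelʳ-≤ : ∀ {p q r} → p Rat.+ r ≤ q Rat.+ r → p ≤ q
+-cancelʳ-≤ {p} {q} {r} le = subst₂ _≤_ (cancel p r) (cancel q r) (Ratₚ.+-monoˡ-≤ (Rat.- r) le)
  where
  open +-*-Solver
  cancel : ∀ x y → x Rat.+ y Rat.+ Rat.- y ≡ x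
  cancel = solve 2 (λ x y → x :+ y :- y := x) refl

^ℚ-+ : ∀ a i j → a ^ℚ (i + j) ≡ a ^ℚ i * a ^ℚ j
^ℚ-+ a zero    j = ≡.sym (Ratₚ.*-identityˡ _)
^ℚ-+ a (suc i) j = ≡.trans (cong (a *_) (^ℚ-+ a i j)) (≡.sym (Ratₚ.*-assoc a _ _))

^ℚ-distrib-* : ∀ a b k → (a * b) ^ℚ k ≡ a ^ℚ k * b ^ℚ k
^ℚ-distrib-* a b zero    = refl
^ℚ-distrib-* a b (suc k) rewrite ^ℚ-distrib-* a b k =
  solve 4 (λ a b x y → (a :* b) :* (x :* y) := (a :* x) :* (b :* y)) refl a b (a ^ℚ k) (b ^ℚ k)
  where open +-*-Solver

^ℚ-nonNeg : ∀ {a} k → 0ℚ ≤ a → 0ℚ ≤ a ^ℚ k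
^ℚ-nonNeg zero    0≤a = Ratₚ.nonNegative⁻¹ 1ℚ
^ℚ-nonNeg (suc k) 0≤a = 0≤-* 0≤a (^ℚ-nonNeg k 0≤a)

^ℚ-mono : ∀ {a b} k → 0ℚ ≤ a → a ≤ b → a ^ℚ k ≤ b ^ℚ k
^ℚ-mono zero    0≤a a≤b = Ratₚ.≤-refl
^ℚ-mono (suc k) 0≤a a≤b =
  *-mono-≤-0≤ 0≤a (^ℚ-nonNeg k (Ratₚ.≤-trans 0≤a a≤b)) a≤b (^ℚ-mono k 0≤a a≤b)

^ℚ-≤1 : ∀ {a} k → 0ℚ ≤ a → a ≤ 1ℚ → a ^ℚ k ≤ 1ℚ
^ℚ-≤1 zero    0≤a a≤1 = Ratₚ.≤-refl
^ℚ-≤1 (suc k) 0≤a a≤1 = *-mono-≤-0≤ 0≤a (Ratₚ.nonNegative⁻¹ 1ℚ) a≤1 (^ℚ-≤1 k 0≤a a≤1)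

-- Booleans, finite sums and counting sequences

[_] : Bool → ℕ
[ b ] = if b then 1 else 0

[]-mono : ∀ a {b} → (a ≡ true → b ≡ true) → [ a ] Nat.≤ [ b ]
[]-mono false imp = z≤n
[]-mono true  imp rewrite imp refl = Natₚ.≤-refl

∧-true⁻ : ∀ {a b} → a ∧ b ≡ true → a ≡ true × b ≡ true
∧-true⁻ {true} {true} refl = refl , refl

≟-true⁻ : ∀ {a b : Bool} → ⌊ a Bool.≟ b ⌋ ≡ true → a ≡ b
≟-true⁻ {a} {b} eq with a Bool.≟ b
... | yes a≡b = a≡b

≟-refl : ∀ a → ⌊ a Bool.≟ a ⌋ ≡ true
≟-refl true  = refl
≟-refl false = refl

exclusive-pair-≤ : ∀ a b e s t → s ∧ t ≡ false →
  [ a ∧ b ∧ s ∧ e ] + [ b ∧ a ∧ t ∧ e ] Nat.≤ [ a ∧ b ∧ e ]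
exclusive-pair-≤ true  true  e true  true  ()
exclusive-pair-≤ true  true  e true  false _ = Natₚ.≤-reflexive (Natₚ.+-identityʳ [ e ])
exclusive-pair-≤ true  true  e false t     _ = []-mono (t ∧ e) (proj₂ ∘ ∧-true⁻)
exclusive-pair-≤ true  false _ _     _     _ = z≤n
exclusive-pair-≤ false true  _ _     _     _ = z≤n
exclusive-pair-≤ false false _ _     _     _ = z≤n

colour-split : ∀ y b → [ y ∧ ⌊ b Bool.≟ true ⌋ ] + [ y ∧ ⌊ b Bool.≟ false ⌋ ] ≡ [ y ]
colour-split false _     = refl
colour-split true  true  = refl
colour-split true  false = refl

<?-exclusive : ∀ {n} (u v : Fin n) → ⌊ u <? v ⌋ ∧ ⌊ v <? u ⌋ ≡ false
<?-exclusive u v with u <? v | v <? u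
... | yes u<v | yes v<u = ⊥-elim (Finₚ.<-asym u<v v<u)
... | yes _   | no _    = refl
... | no _    | _       = refl

∀ᶠ-intro : ∀ m {f} → (∀ i → f i ≡ true) → ∀ᶠ m f ≡ true
∀ᶠ-intro zero    all = refl
∀ᶠ-intro (suc m) all = cong₂ _∧_ (all zero) (∀ᶠ-intro m (all ∘ suc))

∀ᶠ-elim : ∀ m {f} → ∀ᶠ m f ≡ true → ∀ i → f i ≡ true
∀ᶠ-elim (suc m) eq zero    = proj₁ (∧-true⁻ eq)
∀ᶠ-elim (suc m) eq (suc i) = ∀ᶠ-elim m (proj₂ (∧-true⁻ eq)) i

+-double-cancel-≤ : ∀ {a b} → b + b Nat.≤ a + a → b Nat.≤ a
+-double-cancel-≤ b+b≤a+a = Natₚ.≮⇒≥ (λ a<b → Natₚ.<⇒≱ (Natₚ.+-mono-< a<b a<b) b+b≤a+a)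

Σᶠ-sum : ∀ m f → Σᶠ m f ≡ sum f
Σᶠ-sum zero    f = refl
Σᶠ-sum (suc m) f = cong (_+_ (f zero)) (Σᶠ-sum m (f ∘ suc))

Σᶠ-cong : ∀ m {f g : Fin m → ℕ} → (∀ i → f i ≡ g i) → Σᶠ m f ≡ Σᶠ m g
Σᶠ-cong zero    eq = refl
Σᶠ-cong (suc m) eq = cong₂ _+_ (eq zero) (Σᶠ-cong m (eq ∘ suc))

Σᶠ-mono : ∀ m {f g : Fin m → ℕ} → (∀ i → f i Nat.≤ g i) → Σᶠ m f Nat.≤ Σᶠ m g
Σᶠ-mono zero    le = z≤n
Σᶠ-mono (suc m) le = Natₚ.+-mono-≤ (le zero) (Σᶠ-mono m (le ∘ suc))

Σᶠ-zero : ∀ m → Σᶠ m (λ _ → 0) ≡ 0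
Σᶠ-zero zero    = refl
Σᶠ-zero (suc m) = Σᶠ-zero m

Σᶠ-distrib-+ : ∀ m (f g : Fin m → ℕ) → Σᶠ m (λ i → f i + g i) ≡ Σᶠ m f + Σᶠ m g
Σᶠ-distrib-+ m f g = begin
  Σᶠ m (λ i → f i + g i)  ≡⟨ Σᶠ-sum m _ ⟩
  sum (λ i → f i + g i)   ≡⟨ ∑-distrib-+ f g ⟩
  sum f + sum g           ≡⟨ ≡.sym (cong₂ _+_ (Σᶠ-sum m f) (Σᶠ-sum m g)) ⟩
  Σᶠ m f + Σᶠ m g         ∎
  where open ≡-Reasoning

Σᶠ-comm : ∀ m k (f : Fin m → Fin k → ℕ) →
  Σᶠ m (λ i → Σᶠ k (f i)) ≡ Σᶠ k (λ j → Σᶠ m (λ i → f i j))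
Σᶠ-comm zero    k f = ≡.sym (Σᶠ-zero k)
Σᶠ-comm (suc m) k f = ≡.trans (cong (_+_ (Σᶠ k (f zero))) (Σᶠ-comm m k (f ∘ suc)))
                              (≡.sym (Σᶠ-distrib-+ k (f zero) _))

∣∣≡Σᶠ : ∀ {m} (S : Subset m) → ∣ S ∣ ≡ Σᶠ m (λ i → [ lookup S i ])
∣∣≡Σᶠ []          = refl
∣∣≡Σᶠ (true  ∷ S) = cong suc (∣∣≡Σᶠ S)
∣∣≡Σᶠ (false ∷ S) = ∣∣≡Σᶠ S

∣tabulate∣ : ∀ {m} (f : Fin m → Bool) → ∣ tabulate f ∣ ≡ Σᶠ m (λ i → [ f i ])
∣tabulate∣ {m} f = ≡.trans (∣∣≡Σᶠ (tabulate f)) (Σᶠ-cong m (λ i → cong [_] (lookup∘tabulate f i)))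

Σᶠ-affine-bound : ∀ m {a b} (f g h : Fin m → ℕ) →
  (∀ i → a * toℚ (f i) ≤ toℚ (g i) Rat.+ b * toℚ (h i)) →
  a * toℚ (Σᶠ m f) ≤ toℚ (Σᶠ m g) Rat.+ b * toℚ (Σᶠ m h)
Σᶠ-affine-bound zero {a} {b} f g h bound =
  Ratₚ.≤-reflexive (solve 2 (λ a b → a :* con 0ℚ := con 0ℚ :+ b :* con 0ℚ) refl a b)
  where open +-*-Solver
Σᶠ-affine-bound (suc m) {a} {b} f g h bound = begin
  a * toℚ (f zero + F)                ≡⟨ cong (a *_) (toℚ-+ (f zero) F) ⟩
  a * (toℚ (f zero) Rat.+ toℚ F)      ≡⟨ Ratₚ.*-distribˡ-+ a _ _ ⟩
  a * toℚ (f zero) Rat.+ a * toℚ F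
    ≤⟨ Ratₚ.+-mono-≤ (bound zero) (Σᶠ-affine-bound m {a} {b} (f ∘ suc) (g ∘ suc) (h ∘ suc) (bound ∘ suc)) ⟩
  (toℚ (g zero) Rat.+ b * toℚ (h zero)) Rat.+ (toℚ G Rat.+ b * toℚ H)
    ≡⟨ solve 5 (λ g₀ h₀ G H b → (g₀ :+ b :* h₀) :+ (G :+ b :* H) := (g₀ :+ G) :+ b :* (h₀ :+ H)) refl
         (toℚ (g zero)) (toℚ (h zero)) (toℚ G) (toℚ H) b ⟩
  (toℚ (g zero) Rat.+ toℚ G) Rat.+ b * (toℚ (h zero) Rat.+ toℚ H)
    ≡⟨ ≡.sym (cong₂ (λ x y → x Rat.+ b * y) (toℚ-+ (g zero) G) (toℚ-+ (h zero) H)) ⟩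
  toℚ (g zero + G) Rat.+ b * toℚ (h zero + H) ∎
  where
  open Ratₚ.≤-Reasoning
  open +-*-Solver
  F = Σᶠ m (f ∘ suc)
  G = Σᶠ m (g ∘ suc)
  H = Σᶠ m (h ∘ suc)

countSeq-cong : ∀ n k {P Q : (Fin k → Fin n) → Bool} →
  (∀ s → P s ≡ Q s) → countSeq n k P ≡ countSeq n k Q
countSeq-cong n zero    eq = cong [_] (eq _)
countSeq-cong n (suc k) eq = Σᶠ-cong n (λ x → countSeq-cong n k (λ s → eq _))

countSeq-mono : ∀ n k {P Q : (Fin k → Fin n) → Bool} →
  (∀ s → P s ≡ true → Q s ≡ true) → countSeq n k P Nat.≤ countSeq n k Q
countSeq-mono n zero    imp = []-mono _ (imp _)
countSeq-mono n (suc k) imp = Σᶠ-mono n (λ x → countSeq-mono n k (λ s → imp _))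

countSeq-suc-≥ : ∀ n k (Q : Fin n → (Fin k → Fin n) → Bool) {P : (Fin (suc k) → Fin n) → Bool} →
  (∀ v → Q (v zero) (v ∘ suc) ≡ true → P v ≡ true) →
  Σᶠ n (λ x → countSeq n k (Q x)) Nat.≤ countSeq n (suc k) P
countSeq-suc-≥ n k Q imp = Σᶠ-mono n (λ x → countSeq-mono n k (λ s → imp _))

-- The coefficients

¼ ½ : ℚ
¼ = + 1 / 4
½ = + 1 / 2

0≤¼ : 0ℚ ≤ ¼
0≤¼ = Rat.*≤* (Int.+≤+ z≤n)

¼≤1 : ¼ ≤ 1ℚ
¼≤1 = Rat.*≤* (Int.+≤+ (s≤s z≤n))

0≤½ : 0ℚ ≤ ½
0≤½ = Rat.*≤* (Int.+≤+ z≤n)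

½≤1 : ½ ≤ 1ℚ
½≤1 = Rat.*≤* (Int.+≤+ (s≤s z≤n))

suc-C-2 : ∀ m → suc m C 2 ≡ m + m C 2
suc-C-2 m = ≡.trans (≡.sym (Natᶜ.nCk+nC[k+1]≡[n+1]C[k+1] m 1)) (cong (_+ m C 2) (Natᶜ.nC1≡n m))

module Coefficients (d : ℚ) where

  p : ℚ
  p = d * ¼

  coeff : ℕ → ℚ
  coeff zero    = ¼
  coeff (suc k) = coeff k * p ^ℚ suc k

  coeff-closed : ∀ k → coeff k ≡ ¼ * p ^ℚ (suc k C 2)
  coeff-closed zero    = ≡.sym (Ratₚ.*-identityʳ ¼)
  coeff-closed (suc k) = begin
    coeff k * p ^ℚ suc k                 ≡⟨ cong (_* p ^ℚ suc k) (coeff-closed k) ⟩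
    ¼ * p ^ℚ (suc k C 2) * p ^ℚ suc k
      ≡⟨ solve 3 (λ a x y → a :* x :* y := a :* (y :* x)) refl ¼ (p ^ℚ (suc k C 2)) (p ^ℚ suc k) ⟩
    ¼ * (p ^ℚ suc k * p ^ℚ (suc k C 2))  ≡⟨ cong (¼ *_) (≡.sym (^ℚ-+ p (suc k) (suc k C 2))) ⟩
    ¼ * p ^ℚ (suc k + suc k C 2)         ≡⟨ cong (λ e → ¼ * p ^ℚ e) (≡.sym (suc-C-2 (suc k))) ⟩
    ¼ * p ^ℚ (suc (suc k) C 2)           ∎
    where
    open ≡-Reasoning
    open +-*-Solver

  -- With X = p m and Y = coeff k X^k: Y (d m²/2 − X m) = Y d m²/4 = coeff (suc k) m^(k+2).
  coeff-identity : ∀ k m →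
    coeff (suc k) * m ^ℚ suc (suc k) Rat.+ coeff k * (p * m) ^ℚ k * (p * m) * m
      ≡ coeff k * (p * m) ^ℚ k * (d * m * m * ½)
  coeff-identity k m rewrite ^ℚ-distrib-* p m k =
    solve 5 (λ C P M d m → C :* ((d :* con ¼) :* P) :* (m :* (m :* M))
                             :+ C :* (P :* M) :* ((d :* con ¼) :* m) :* m
                           := C :* (P :* M) :* (d :* m :* m :* con ½))
      refl (coeff k) (p ^ℚ k) (m ^ℚ k) d m
    where open +-*-Solver

  module _ (0≤d : 0ℚ ≤ d) where

    0≤p : 0ℚ ≤ p
    0≤p = 0≤-* 0≤d 0≤¼

    0≤coeff : ∀ k → 0ℚ ≤ coeff k
    0≤coeff zero    = 0≤¼
    0≤coeff (suc k) = 0≤-* (0≤coeff k) (^ℚ-nonNeg (suc k) 0≤p)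

    ¼^C*d^C≤coeff : ∀ k → ¼ ^ℚ ((suc k + 1) C 2) * d ^ℚ (suc k C 2) ≤ coeff k
    ¼^C*d^C≤coeff k = begin
      ¼ ^ℚ ((suc k + 1) C 2) * d ^ℚ T
        ≡⟨ cong (λ e → ¼ ^ℚ e * d ^ℚ T)
             (≡.trans (cong (_C 2) (Natₚ.+-comm (suc k) 1)) (suc-C-2 (suc k))) ⟩
      ¼ ^ℚ (suc k + T) * d ^ℚ T
        ≡⟨ cong (_* d ^ℚ T) (^ℚ-+ ¼ (suc k) T) ⟩
      ¼ ^ℚ suc k * ¼ ^ℚ T * d ^ℚ T
        ≤⟨ *-monoʳ-≤-0≤ (^ℚ-nonNeg T 0≤d) (*-monoʳ-≤-0≤ (^ℚ-nonNeg T 0≤¼) ¼^suc≤¼) ⟩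
      ¼ * ¼ ^ℚ T * d ^ℚ T
        ≡⟨ solve 3 (λ a x y → a :* x :* y := a :* (y :* x)) refl ¼ (¼ ^ℚ T) (d ^ℚ T) ⟩
      ¼ * (d ^ℚ T * ¼ ^ℚ T)
        ≡⟨ cong (¼ *_) (≡.sym (^ℚ-distrib-* d ¼ T)) ⟩
      ¼ * p ^ℚ T
        ≡⟨ ≡.sym (coeff-closed k) ⟩
      coeff k ∎
      where
      open Ratₚ.≤-Reasoning
      open +-*-Solver
      T = suc k C 2
      ¼^suc≤¼ : ¼ ^ℚ suc k ≤ ¼
      ¼^suc≤¼ = Ratₚ.≤-trans (*-monoˡ-≤-0≤ 0≤¼ (^ℚ-≤1 k 0≤¼ ¼≤1)) (Ratₚ.≤-reflexive (Ratₚ.*-identityʳ ¼))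

-- Canonical sequences and majority neighbourhoods

module _ {n} (Γ : Graph n) (c : Colouring Γ) where

  Canonical : ∀ {ℓ} → (Fin ℓ → Fin n) → Set
  Canonical v = ∀ {i j k} → i Fin.< j → i Fin.< k →
    adj Γ (v i) (v j) ≡ true × col c (v i) (v j) ≡ col c (v i) (v k)

  Canonical⇒canonical : ∀ ℓ (v : Fin ℓ → Fin n) → Canonical v → canonical Γ c ℓ v ≡ true
  Canonical⇒canonical ℓ v can =
    ∀ᶠ-intro ℓ (λ i → ∀ᶠ-intro ℓ (λ j → ∀ᶠ-intro ℓ (λ k → entry i j k)))
    where
    entry : ∀ i j k → (if ⌊ i <? j ⌋ ∧ ⌊ i <? k ⌋
                       then adj Γ (v i) (v j) ∧ ⌊ col c (v i) (v j) Bool.≟ col c (v i) (v k) ⌋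
                       else true) ≡ true
    entry i j k with i <? j | i <? k
    ... | no _    | _       = refl
    ... | yes _   | no _    = refl
    ... | yes i<j | yes i<k with can i<j i<k
    ...   | edge , same rewrite same = cong₂ _∧_ edge (≟-refl _)

  canonical⇒Canonical : ∀ ℓ (v : Fin ℓ → Fin n) → canonical Γ c ℓ v ≡ true → Canonical v
  canonical⇒Canonical ℓ v holds {i} {j} {k} i<j i<k =
    entry (∀ᶠ-elim ℓ (∀ᶠ-elim ℓ (∀ᶠ-elim ℓ holds i) j) k)
    where
    entry : (if ⌊ i <? j ⌋ ∧ ⌊ i <? k ⌋
             then adj Γ (v i) (v j) ∧ ⌊ col c (v i) (v j) Bool.≟ col c (v i) (v k) ⌋
             else true) ≡ true →
            adj Γ (v i) (v j) ≡ true × col c (v i) (v j) ≡ col c (v i) (v k)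
    entry holdsᵢⱼₖ with i <? j | i <? k
    ... | no i≮j | _      = ⊥-elim (i≮j i<j)
    ... | yes _  | no i≮k = ⊥-elim (i≮k i<k)
    ... | yes _  | yes _  with ∧-true⁻ holdsᵢⱼₖ
    ...   | edge , same = edge , ≟-true⁻ same

  Canonical-cons : ∀ {ℓ} (v : Fin (suc ℓ) → Fin n) (b : Bool) →
    (∀ j → adj Γ (v zero) (v (suc j)) ≡ true × col c (v zero) (v (suc j)) ≡ b) →
    Canonical (v ∘ suc) → Canonical v
  Canonical-cons v b head tail {zero}  {suc j} {suc k} _   _   =
    proj₁ (head j) , ≡.trans (proj₂ (head j)) (≡.sym (proj₂ (head k)))
  Canonical-cons v b head tail {suc i} {suc j} {suc k} i<j i<k = tail (Nat.s<s⁻¹ i<j) (Nat.s<s⁻¹ i<k)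
  Canonical-cons v b head tail {_}     {zero}  ()
  Canonical-cons v b head tail {zero}  {suc j} {zero}  _ ()
  Canonical-cons v b head tail {suc i} {suc j} {zero}  _ ()

  canonicalIn : Subset n → ∀ k → (Fin k → Fin n) → Bool
  canonicalIn S k v = ∀ᶠ k (λ j → lookup S (v j)) ∧ canonical Γ c k v

  numCanonicalIn : Subset n → ℕ → ℕ
  numCanonicalIn S k = countSeq n k (canonicalIn S k)

  canonicalIn⁺ : ∀ S k v → (∀ j → lookup S (v j) ≡ true) → Canonical v → canonicalIn S k v ≡ true
  canonicalIn⁺ S k v inS can = cong₂ _∧_ (∀ᶠ-intro k inS) (Canonical⇒canonical k v can)

  canonicalIn⁻ : ∀ S k v → canonicalIn S k v ≡ true → (∀ j → lookup S (v j) ≡ true) × Canonical v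
  canonicalIn⁻ S k v holds =
    let inS , can = ∧-true⁻ {∀ᶠ k (λ j → lookup S (v j))} holds
    in ∀ᶠ-elim k inS , canonical⇒Canonical k v can

  numCanonicalIn-⊤ : ∀ ℓ → numCanonicalIn ⊤ ℓ ≡ numCanonical Γ c ℓ
  numCanonicalIn-⊤ ℓ = countSeq-cong n ℓ (λ v → cong (_∧ canonical Γ c ℓ v)
    (∀ᶠ-intro ℓ (λ j → lookup-replicate (v j) true)))

  ∣∣≤numCanonicalIn-1 : ∀ S → ∣ S ∣ Nat.≤ numCanonicalIn S 1
  ∣∣≤numCanonicalIn-1 S rewrite ∣∣≡Σᶠ S = countSeq-suc-≥ n 0 (λ x _ → lookup S x) single
    where
    single : ∀ v → lookup S (v zero) ≡ true → canonicalIn S 1 v ≡ true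
    single v v₀∈S rewrite v₀∈S = refl

  edgeIn : Subset n → Fin n → Fin n → Bool
  edgeIn S x u = lookup S x ∧ lookup S u ∧ adj Γ x u

  degreeIn : Subset n → Fin n → ℕ
  degreeIn S x = Σᶠ n (λ u → [ edgeIn S x u ])

  edgesIn-handshake : ∀ S → edgesIn Γ S + edgesIn Γ S Nat.≤ Σᶠ n (degreeIn S)
  edgesIn-handshake S = begin
    edgesIn Γ S + edgesIn Γ S
      ≡⟨ cong (_+_ (edgesIn Γ S)) (Σᶠ-comm n n ordered) ⟩
    Σᶠ n (λ u → Σᶠ n (ordered u)) + Σᶠ n (λ u → Σᶠ n (λ v → ordered v u))
      ≡⟨ ≡.sym (Σᶠ-distrib-+ n _ _) ⟩
    Σᶠ n (λ u → Σᶠ n (ordered u) + Σᶠ n (λ v → ordered v u))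
      ≡⟨ Σᶠ-cong n (λ u → ≡.sym (Σᶠ-distrib-+ n (ordered u) (λ v → ordered v u))) ⟩
    Σᶠ n (λ u → Σᶠ n (λ v → ordered u v + ordered v u))
      ≤⟨ Σᶠ-mono n (λ u → Σᶠ-mono n (pair u)) ⟩
    Σᶠ n (degreeIn S) ∎
    where
    open Natₚ.≤-Reasoning
    ordered : Fin n → Fin n → ℕ
    ordered u v = [ lookup S u ∧ lookup S v ∧ ⌊ u <? v ⌋ ∧ adj Γ u v ]
    pair : ∀ u v → ordered u v + ordered v u Nat.≤ [ edgeIn S u v ]
    pair u v rewrite Graph.sym Γ v u =
      exclusive-pair-≤ (lookup S u) (lookup S v) (adj Γ u v) ⌊ u <? v ⌋ ⌊ v <? u ⌋ (<?-exclusive u v)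

  joinedIn : Subset n → Fin n → Bool → Fin n → Bool
  joinedIn S x b u = edgeIn S x u ∧ ⌊ col c x u Bool.≟ b ⌋

  joinedIn⁻ : ∀ S x b u → joinedIn S x b u ≡ true →
    lookup S x ≡ true × lookup S u ≡ true × adj Γ x u ≡ true × col c x u ≡ b
  joinedIn⁻ S x b u joined =
    let edge , same = ∧-true⁻ joined
        x∈S , rest  = ∧-true⁻ edge
        u∈S , xu    = ∧-true⁻ rest
    in x∈S , u∈S , xu , ≟-true⁻ same

  colourDegreeIn : Subset n → Fin n → Bool → ℕ
  colourDegreeIn S x b = Σᶠ n (λ u → [ joinedIn S x b u ])

  majorityColour : Subset n → Fin n → Bool
  majorityColour S x = ⌊ colourDegreeIn S x false Nat.≤? colourDegreeIn S x true ⌋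

  majorityDegree : Subset n → Fin n → ℕ
  majorityDegree S x = colourDegreeIn S x (majorityColour S x)

  majorityNeighbourhood : Subset n → Fin n → Subset n
  majorityNeighbourhood S x = tabulate (joinedIn S x (majorityColour S x))

  ∣majorityNeighbourhood∣ : ∀ S x → ∣ majorityNeighbourhood S x ∣ ≡ majorityDegree S x
  ∣majorityNeighbourhood∣ S x = ∣tabulate∣ (joinedIn S x (majorityColour S x))

  majorityDegree-outside : ∀ S x → lookup S x ≡ false → majorityDegree S x ≡ 0
  majorityDegree-outside S x x∉S rewrite x∉S = Σᶠ-zero n

  degreeIn≤2*majorityDegree : ∀ S x → degreeIn S x Nat.≤ majorityDegree S x + majorityDegree S x
  degreeIn≤2*majorityDegree S x = begin
    degreeIn S x
      ≡⟨ Σᶠ-cong n (λ u → ≡.sym (colour-split (edgeIn S x u) (col c x u))) ⟩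
    Σᶠ n (λ u → [ joinedIn S x true u ] + [ joinedIn S x false u ])
      ≡⟨ Σᶠ-distrib-+ n _ _ ⟩
    colourDegreeIn S x true + colourDegreeIn S x false
      ≤⟨ majority ⟩
    majorityDegree S x + majorityDegree S x ∎
    where
    open Natₚ.≤-Reasoning
    majority : colourDegreeIn S x true + colourDegreeIn S x false Nat.≤
               majorityDegree S x + majorityDegree S x
    majority with colourDegreeIn S x false Nat.≤? colourDegreeIn S x true
    ... | yes f≤t = Natₚ.+-monoʳ-≤ _ f≤t
    ... | no f≰t  = Natₚ.+-monoˡ-≤ _ (Natₚ.<⇒≤ (Natₚ.≰⇒> f≰t))

  edgesIn≤Σmajority : ∀ S → edgesIn Γ S Nat.≤ Σᶠ n (majorityDegree S)
  edgesIn≤Σmajority S = +-double-cancel-≤ (begin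
    edgesIn Γ S + edgesIn Γ S                             ≤⟨ edgesIn-handshake S ⟩
    Σᶠ n (degreeIn S)                                     ≤⟨ Σᶠ-mono n (degreeIn≤2*majorityDegree S) ⟩
    Σᶠ n (λ x → majorityDegree S x + majorityDegree S x)  ≡⟨ Σᶠ-distrib-+ n _ _ ⟩
    Σᶠ n (majorityDegree S) + Σᶠ n (majorityDegree S)     ∎)
    where open Natₚ.≤-Reasoning

  Σmajority≤numCanonicalIn : ∀ S k →
    Σᶠ n (λ x → numCanonicalIn (majorityNeighbourhood S x) (suc k)) Nat.≤ numCanonicalIn S (suc (suc k))
  Σmajority≤numCanonicalIn S k =
    countSeq-suc-≥ n (suc k) (λ x → canonicalIn (majorityNeighbourhood S x) (suc k)) prepend
    where
    prepend : ∀ v → canonicalIn (majorityNeighbourhood S (v zero)) (suc k) (v ∘ suc) ≡ true →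
              canonicalIn S (suc (suc k)) v ≡ true
    prepend v holds = canonicalIn⁺ S (suc (suc k)) v inS
      (Canonical-cons v b (λ j → proj₂ (proj₂ (joined j))) (proj₂ tail))
      where
      b = majorityColour S (v zero)
      tail = canonicalIn⁻ (majorityNeighbourhood S (v zero)) (suc k) (v ∘ suc) holds
      joined : ∀ j → lookup S (v zero) ≡ true × lookup S (v (suc j)) ≡ true ×
                     adj Γ (v zero) (v (suc j)) ≡ true × col c (v zero) (v (suc j)) ≡ b
      joined j = joinedIn⁻ S (v zero) b (v (suc j))
        (≡.trans (≡.sym (lookup∘tabulate (joinedIn S (v zero) b) (v (suc j)))) (proj₁ tail j))
      inS : ∀ j → lookup S (v j) ≡ true
      inS zero    = proj₁ (joined zero)
      inS (suc j) = proj₁ (proj₂ (joined j))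

  -- The counting argument

  module Counting {ρ d : ℚ} (0≤d : 0ℚ ≤ d) (d≤1 : d ≤ 1ℚ) (dense : Dense ρ d Γ) where

    open Coefficients d

    p≤1 : p ≤ 1ℚ
    p≤1 = *-mono-≤-0≤ 0≤d (Ratₚ.nonNegative⁻¹ 1ℚ) d≤1 ¼≤1

    -- Level k bounds the canonical sequences of length k + 1; those of length 1 need no density.
    Large : ℕ → ℕ → Set
    Large zero    m = Unit
    Large (suc k) m = ρ * toℚ n ≤ p ^ℚ k * ½ * toℚ m

    Large⇒ρn≤ : ∀ k {m} → Large (suc k) m → ρ * toℚ n ≤ toℚ m
    Large⇒ρn≤ k {m} large = Ratₚ.≤-trans large (Ratₚ.≤-trans
      (*-monoʳ-≤-0≤ (toℚ-nonNeg m)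
        (*-mono-≤-0≤ (^ℚ-nonNeg k (0≤p 0≤d)) (Ratₚ.nonNegative⁻¹ 1ℚ) (^ℚ-≤1 k (0≤p 0≤d) p≤1) ½≤1))
      (Ratₚ.≤-reflexive (Ratₚ.*-identityˡ (toℚ m))))

    Large-shrink : ∀ k {m m′} → p * toℚ m ≤ toℚ m′ → Large (suc k) m → Large k m′
    Large-shrink zero    _      _     = tt
    Large-shrink (suc k) {m} pm≤m′ large = Ratₚ.≤-trans large (Ratₚ.≤-trans (Ratₚ.≤-reflexive regroup)
      (*-monoˡ-≤-0≤ (0≤-* (^ℚ-nonNeg k (0≤p 0≤d)) 0≤½) pm≤m′))
      where
      open +-*-Solver
      regroup : p ^ℚ suc k * ½ * toℚ m ≡ p ^ℚ k * ½ * (p * toℚ m)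
      regroup = solve 3 (λ p P m → p :* P :* con ½ :* m := P :* con ½ :* (p :* m)) refl p (p ^ℚ k) (toℚ m)

    ½dm²≤Σmajority : ∀ S → ρ * toℚ n ≤ toℚ ∣ S ∣ →
      d * toℚ ∣ S ∣ * toℚ ∣ S ∣ * ½ ≤ toℚ (Σᶠ n (majorityDegree S))
    ½dm²≤Σmajority S ρn≤∣S∣ = Ratₚ.≤-trans (dense S ρn≤∣S∣) (toℚ-mono (edgesIn≤Σmajority S))

    LowerBound : ℕ → Set
    LowerBound k = ∀ S → Large k ∣ S ∣ → coeff k * toℚ ∣ S ∣ ^ℚ suc k ≤ toℚ (numCanonicalIn S (suc k))

    lowerBound-zero : LowerBound 0
    lowerBound-zero S _ = begin
      ¼ * (toℚ ∣ S ∣ * 1ℚ)      ≡⟨ cong (¼ *_) (Ratₚ.*-identityʳ (toℚ ∣ S ∣)) ⟩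
      ¼ * toℚ ∣ S ∣             ≤⟨ *-monoʳ-≤-0≤ (toℚ-nonNeg ∣ S ∣) ¼≤1 ⟩
      1ℚ * toℚ ∣ S ∣            ≡⟨ Ratₚ.*-identityˡ (toℚ ∣ S ∣) ⟩
      toℚ ∣ S ∣                 ≤⟨ toℚ-mono (∣∣≤numCanonicalIn-1 S) ⟩
      toℚ (numCanonicalIn S 1)  ∎
      where open Ratₚ.≤-Reasoning

    -- Either the majority neighbourhood of x has at least X vertices and the induction
    -- hypothesis applies to it, or it has fewer (and none at all when x ∉ S).
    majorityDegree-bound : ∀ k → LowerBound k → ∀ S {m} → Large (suc k) m → ∀ x →
      let X = p * toℚ m in
      coeff k * X ^ℚ k * toℚ (majorityDegree S x)
        ≤ toℚ (numCanonicalIn (majorityNeighbourhood S x) (suc k))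
          Rat.+ coeff k * X ^ℚ k * X * toℚ [ lookup S x ]
    majorityDegree-bound k IH S {m} large x = bound (Ratₚ.≤-total X (toℚ M))
      where
      open Ratₚ.≤-Reasoning
      open +-*-Solver
      X = p * toℚ m
      Y = coeff k * X ^ℚ k
      M = majorityDegree S x
      N = majorityNeighbourhood S x
      0≤X : 0ℚ ≤ X
      0≤X = 0≤-* (0≤p 0≤d) (toℚ-nonNeg m)
      0≤Y : 0ℚ ≤ Y
      0≤Y = 0≤-* (0≤coeff 0≤d k) (^ℚ-nonNeg k 0≤X)
      N-bound : X ≤ toℚ M → coeff k * toℚ M ^ℚ suc k ≤ toℚ (numCanonicalIn N (suc k))
      N-bound X≤M = subst (λ e → Large k e → coeff k * toℚ e ^ℚ suc k ≤ toℚ (numCanonicalIn N (suc k)))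
        (∣majorityNeighbourhood∣ S x) (IH N) (Large-shrink k {m} X≤M large)
      M≤X*[x∈S] : ∀ b → lookup S x ≡ b → toℚ M ≤ X → toℚ M ≤ X * toℚ [ b ]
      M≤X*[x∈S] true  _   M≤X = Ratₚ.≤-trans M≤X (Ratₚ.≤-reflexive (≡.sym (Ratₚ.*-identityʳ X)))
      M≤X*[x∈S] false x∉S _   rewrite majorityDegree-outside S x x∉S =
        Ratₚ.≤-reflexive (≡.sym (Ratₚ.*-zeroʳ X))
      bound : X ≤ toℚ M ⊎ toℚ M ≤ X →
        Y * toℚ M ≤ toℚ (numCanonicalIn N (suc k)) Rat.+ Y * X * toℚ [ lookup S x ]
      bound (inj₁ X≤M) = begin
        Y * toℚ M
          ≤⟨ *-monoʳ-≤-0≤ (toℚ-nonNeg M) (*-monoˡ-≤-0≤ (0≤coeff 0≤d k) (^ℚ-mono k 0≤X X≤M)) ⟩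
        coeff k * toℚ M ^ℚ k * toℚ M
          ≡⟨ solve 3 (λ a x y → a :* x :* y := a :* (y :* x)) refl (coeff k) (toℚ M ^ℚ k) (toℚ M) ⟩
        coeff k * toℚ M ^ℚ suc k
          ≤⟨ N-bound X≤M ⟩
        toℚ (numCanonicalIn N (suc k))
          ≤⟨ p≤p+q (0≤-* (0≤-* 0≤Y 0≤X) (toℚ-nonNeg [ lookup S x ])) ⟩
        toℚ (numCanonicalIn N (suc k)) Rat.+ Y * X * toℚ [ lookup S x ] ∎
      bound (inj₂ M≤X) = begin
        Y * toℚ M
          ≤⟨ *-monoˡ-≤-0≤ 0≤Y (M≤X*[x∈S] (lookup S x) refl M≤X) ⟩
        Y * (X * toℚ [ lookup S x ])
          ≡⟨ ≡.sym (Ratₚ.*-assoc Y X _) ⟩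
        Y * X * toℚ [ lookup S x ]
          ≤⟨ p≤q+p (toℚ-nonNeg (numCanonicalIn N (suc k))) ⟩
        toℚ (numCanonicalIn N (suc k)) Rat.+ Y * X * toℚ [ lookup S x ] ∎

    lowerBound-suc : ∀ k → LowerBound k → LowerBound (suc k)
    lowerBound-suc k IH S large = +-cancelʳ-≤ (begin
      coeff (suc k) * m ^ℚ suc (suc k) Rat.+ Y * X * m
        ≡⟨ coeff-identity k m ⟩
      Y * (d * m * m * ½)
        ≤⟨ *-monoˡ-≤-0≤ 0≤Y (½dm²≤Σmajority S (Large⇒ρn≤ k {∣ S ∣} large)) ⟩
      Y * toℚ (Σᶠ n (majorityDegree S))
        ≤⟨ Σᶠ-affine-bound n {Y} {Y * X} (majorityDegree S) extensions (λ x → [ lookup S x ])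
             (majorityDegree-bound k IH S {∣ S ∣} large) ⟩
      toℚ (Σᶠ n extensions) Rat.+ Y * X * toℚ (Σᶠ n (λ x → [ lookup S x ]))
        ≡⟨ cong (λ e → toℚ (Σᶠ n extensions) Rat.+ Y * X * toℚ e) (≡.sym (∣∣≡Σᶠ S)) ⟩
      toℚ (Σᶠ n extensions) Rat.+ Y * X * m
        ≤⟨ Ratₚ.+-monoˡ-≤ (Y * X * m) (toℚ-mono (Σmajority≤numCanonicalIn S k)) ⟩
      toℚ (numCanonicalIn S (suc (suc k))) Rat.+ Y * X * m ∎)
      where
      open Ratₚ.≤-Reasoning
      m = toℚ ∣ S ∣
      X = p * m
      Y = coeff k * X ^ℚ k
      0≤Y : 0ℚ ≤ Y
      0≤Y = 0≤-* (0≤coeff 0≤d k) (^ℚ-nonNeg k (0≤-* (0≤p 0≤d) (toℚ-nonNeg ∣ S ∣)))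
      extensions : Fin n → ℕ
      extensions x = numCanonicalIn (majorityNeighbourhood S x) (suc k)

    lowerBound : ∀ k → LowerBound k
    lowerBound zero    = lowerBound-zero
    lowerBound (suc k) = lowerBound-suc k (lowerBound k)

proposition2p3 : (ℓ : ℕ) → ℓ ≥ 2 → (d ρ : ℚ) → 0ℚ < d → d < 1ℚ →
    (n : ℕ) → (+ 2 / 1) * (+ 4 / 1) ^ℚ (ℓ ∸ 2) ≤ (toℚ n) * d ^ℚ (ℓ ∸ 2) →
    0ℚ < ρ → ρ ≤ (d * (+ 1 / 4)) ^ℚ (ℓ ∸ 2) * (+ 1 / 2) →
    (Γ : Graph n) → Dense ρ d Γ → (c : Colouring Γ) →
    (+ 1 / 4) ^ℚ ((ℓ + 1) C 2) * d ^ℚ (ℓ C 2) * (toℚ n) ^ℚ ℓ ≤ (toℚ (numCanonical Γ c ℓ))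
proposition2p3 zero          ()
proposition2p3 (suc zero)    (s≤s ())
proposition2p3 (suc (suc k)) _ d ρ 0<d d<1 n _ _ ρ≤ Γ dense c = begin
  ¼ ^ℚ ((ℓ + 1) C 2) * d ^ℚ (ℓ C 2) * toℚ n ^ℚ ℓ
    ≤⟨ *-monoʳ-≤-0≤ (^ℚ-nonNeg ℓ (toℚ-nonNeg n)) (¼^C*d^C≤coeff 0≤d (suc k)) ⟩
  coeff (suc k) * toℚ n ^ℚ ℓ
    ≡⟨ cong (λ e → coeff (suc k) * toℚ e ^ℚ ℓ) (≡.sym (∣⊤∣≡n n)) ⟩
  coeff (suc k) * toℚ ∣ ⊤ {n} ∣ ^ℚ ℓ
    ≤⟨ lowerBound (suc k) ⊤ large ⟩
  toℚ (numCanonicalIn Γ c ⊤ ℓ)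
    ≡⟨ cong toℚ (numCanonicalIn-⊤ Γ c ℓ) ⟩
  toℚ (numCanonical Γ c ℓ) ∎
  where
  open Ratₚ.≤-Reasoning
  ℓ = suc (suc k)
  0≤d = Ratₚ.<⇒≤ 0<d
  open Coefficients d using (coeff; p; ¼^C*d^C≤coeff)
  open Counting Γ c {ρ} {d} 0≤d (Ratₚ.<⇒≤ d<1) dense
  large : Large (suc k) ∣ ⊤ {n} ∣
  large = subst (λ e → ρ * toℚ n ≤ p ^ℚ k * ½ * toℚ e) (≡.sym (∣⊤∣≡n n)) (*-monoʳ-≤-0≤ (toℚ-nonNeg n) ρ≤)
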